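{- Let $G$ be a $P_9$-free chordal graph with irredundant components $C_1,\dots,C_\ell$, and let $A\subseteq RN(G)$. Then $A\in\mathcal{D}_{RN}(G)$ if and only if every $a\in A$ has an irredundant private neighbour w.r.t. $A$ (i.e. $Priv_{IR}(A,a)\neq\emptyset$), and for every $i\in\{1,\dots,\ell\}$ there exists $D_i\subseteq C_i$ such that (1) $D_i$ dominates $C_i\setminus N(A)$, and (2) $D_i$ does not dominate $Priv_{IR}(A,x)$ for any $x\in R_i(A)$.
   Context: All graphs are finite, simple and undirected. $N(x)$, $N[x]=N(x)\cup\{x\}$ are the open and closed neighbourhoods; for $X\subseteq V(G)$, $N[X]=\bigcup_{x\in X}N[x]$ and $N(X)=N[X]\setminus X$. $D$ dominates $X$ if $X\subseteq N[D]$; a minimal dominating set of $G$ is an inclusion-minimal set dominating $V(G)$. A vertex $x$ is irredundant if $N[x]$ is inclusion-minimal in $\{N[y]:y\in V(G)\}$, with the convention that among several vertices having the same inclusion-minimal closed neighbourhood exactly one (fixed) is declared irredundant; all other vertices are redundant. $IR(G)$, $RN(G)$ are the sets of irredundant and redundant vertices; an irredundant component is the vertex set of a connected component of $G[IR(G)]$. For $D\subseteq V(G)$ and $x\in D$, a private neighbour of $x$ w.r.t. $D$ is a vertex $u$ with $N[u]\cap D=\{x\}$ (possibly $u=x$); $Priv_{IR}(D,x)$ is the set of such private neighbours lying in $IR(G)$. $\mathcal{D}_{RN}(G)=\{D\cap RN(G): D\text{ a minimal dominating set of }G\}$. For $A\subseteq RN(G)$: $B(A)$ is the set of $a\in A$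 having an element of $Priv_{IR}(A,a)$ in some irredundant component $C$ with $C\subseteq N(A)$; $R(A)=A\setminus B(A)$; $R_i(A)$ is the set of $x\in R(A)$ having at least one private neighbour w.r.t. $A$ in $C_i$. $P_9$-free means no induced path on $9$ vertices; chordal means no induced cycle of length at least four. -}

module Defs where

open import Data.Nat using (ℕ; suc; _≤_)
open import Data.Bool using (Bool; true; false)
open import Data.Fin using (Fin; toℕ)
open import Data.Fin.Subset using (Subset; _∈_; _∉_)
open import Data.Product using (Σ; ∃; _×_; _,_)
open import Data.Sum using (_⊎_)
open import Relation.Nullary using (¬_)
open import Relation.Binary.PropositionalEquality using (_≡_)
open import Function using (Injective)
open import Data.Unit using (⊤)

record Graph (n : ℕ) : Set where
  field
    adj    : Fin n → Fin n → Bool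
    sym    : ∀ x y → adj x y ≡ adj y x
    irrefl : ∀ x → adj x x ≡ false

module _ {n : ℕ} (G : Graph n) where
  open Graph G

  VPred : Set₁
  VPred = Fin n → Set

  E : Fin n → Fin n → Set
  E x y = adj x y ≡ true

  CN : Fin n → Fin n → Set
  CN x y = x ≡ y ⊎ E x y

  InCN : Subset n → Fin n → Set
  InCN D y = Σ (Fin n) λ x → x ∈ D × CN x y

  InON : Subset n → Fin n → Set
  InON D y = InCN D y × y ∉ D

  Dominates : Subset n → VPred → Set
  Dominates D X = ∀ x → X x → InCN D x

  AllV : VPred
  AllV _ = ⊤

  SubsetOf : Subset n → Subset n → Set
  SubsetOf A B = ∀ x → x ∈ A → x ∈ B

  MinimalDominating : Subset n → Set
  MinimalDominating D =
    Dominates D AllV × (∀ D' → SubsetOf D' D → Dominates D' AllV → SubsetOf D D')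

  NbhdSub : Fin n → Fin n → Set
  NbhdSub x y = ∀ z → CN x z → CN y z

  MinNbhd : Fin n → Set
  MinNbhd x = ∀ y → NbhdSub y x → NbhdSub x y

  -- I is a valid choice of the set IR(G) of irredundant vertices:
  -- from each class of vertices sharing the same inclusion-minimal closed
  -- neighbourhood exactly one vertex is declared irredundant.
  record IsIRChoice (I : Subset n) : Set where
    field
      only-minimal : ∀ x → x ∈ I → MinNbhd x
      some-rep     : ∀ x → MinNbhd x →
                     Σ (Fin n) λ y → y ∈ I × NbhdSub x y × NbhdSub y x
      unique-rep   : ∀ x y → x ∈ I → y ∈ I → NbhdSub x y → NbhdSub y x → x ≡ y

  PathAdj : ∀ {k} → Fin k → Fin k → Set
  PathAdj i j = toℕ j ≡ suc (toℕ i) ⊎ toℕ i ≡ suc (toℕ j)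

  InducedP9 : Set
  InducedP9 = Σ (Fin 9 → Fin n) λ v →
    Injective _≡_ _≡_ v × (∀ i j → (E (v i) (v j) → PathAdj i j) × (PathAdj i j → E (v i) (v j)))

  P9Free : Set
  P9Free = ¬ InducedP9

  CycAdj : (k : ℕ) → Fin k → Fin k → Set
  CycAdj k i j = PathAdj i j ⊎ (toℕ i ≡ 0 × suc (toℕ j) ≡ k) ⊎ (toℕ j ≡ 0 × suc (toℕ i) ≡ k)

  InducedCycle : ℕ → Set
  InducedCycle k = Σ (Fin k → Fin n) λ v →
    Injective _≡_ _≡_ v × (∀ i j → (E (v i) (v j) → CycAdj k i j) × (CycAdj k i j → E (v i) (v j)))

  Chordal : Set
  Chordal = ∀ k → 4 ≤ k → ¬ InducedCycle k

  -- reachability by a walk staying inside S (after the start vertex)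
  data ReachIn (S : Subset n) : Fin n → Fin n → Set where
    here : ∀ {x} → ReachIn S x x
    step : ∀ {x y z} → E x y → y ∈ S → ReachIn S y z → ReachIn S x z

  record IsComponentOf (I C : Subset n) : Set where
    field
      nonempty  : Σ (Fin n) λ x → x ∈ C
      inside    : SubsetOf C I
      connected : ∀ x y → x ∈ C → y ∈ C → ReachIn C x y
      closed    : ∀ x y → x ∈ C → y ∈ I → E x y → y ∈ C

  Priv : Subset n → Fin n → VPred
  Priv D x u = CN u x × (∀ y → y ∈ D → CN u y → y ≡ x)

  PrivIR : Subset n → Subset n → Fin n → VPred
  PrivIR I D x u = Priv D x u × u ∈ I

  -- A ∈ 𝒟_RN(G), where RN(G) is the complement of I = IR(G)
  InDRN : Subset n → Subset n → Set
  InDRN I A = Σ (Subset n) λ D → MinimalDominating D ×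
    (∀ x → (x ∈ A → x ∈ D × x ∉ I) × (x ∈ D × x ∉ I → x ∈ A))

  InB : Subset n → Subset n → Fin n → Set
  InB I A a = a ∈ A × Σ (Fin n) λ u → PrivIR I A a u ×
    Σ (Subset n) λ C → IsComponentOf I C × u ∈ C × (∀ y → y ∈ C → InON A y)

  InR : Subset n → Subset n → Fin n → Set
  InR I A x = x ∈ A × ¬ InB I A x

  InRi : Subset n → Subset n → Subset n → Fin n → Set
  InRi I A C x = InR I A x × Σ (Fin n) λ u → u ∈ C × Priv A x u

module Submission where

-- Necessity is elementary: in a minimal dominating set D every vertex has a
-- private neighbour, which can be pushed down to an irredundant vertex
-- (every closed neighbourhood contains that of an irredundant vertex), and
-- D ∩ C serves as D_C for each irredundant component C.
--
-- Sufficiency builds D₀ = A ∪ ⋃ D_C, where components C ⊆ N(A) contribute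
-- nothing, and shrinks D₀ to a minimal dominating set; this keeps A as long
-- as every a ∈ A has a private neighbour w.r.t. D₀.  The graph theory enters
-- through one structural lemma: a redundant vertex x cannot partly see two
-- irredundant components.  Its proof builds in each component an induced path
-- (an "arm") x a₁ a₂ a₃ a₄, using minimality of irredundant neighbourhoods,
-- and glues the two arms into an induced P₉.  Gluing rests on a general fact
-- about chordal graphs: induced paths leaving x through far-apart vertices
-- stay far apart, since a first contact would close a chordless cycle.

open import Defs
open import Data.Nat using (ℕ; zero; suc; s≤s; z≤n)
open import Data.Bool using (true)
open import Data.Bool.Properties using () renaming (_≟_ to _≟ᵇ_)
open import Data.Fin using (Fin; zero; suc; toℕ)
open import Data.Fin.Properties using (¬∀⟶∃¬; any?; all?) renaming (_≟_ to _≟ᶠ_)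
open import Data.Fin.Subset using (Subset; _∈_; _∉_; _⊆_; _⊂_; _⊃_; _-_; _∪_; _∩_; ⁅_⁆) renaming (⊥ to ∅)
open import Data.Fin.Subset.Properties using (_∈?_; p─q⊆p; x∈p∧x≢y⇒x∈p-y; x∈p⇒p-x⊂p; ⊆-antisym; p⊆p∪q; x∈p∪q⁺; x∈p∪q⁻; x∈⁅x⁆; x∈⁅y⁆⇒x≡y; x∈p∩q⁺; x∈p∩q⁻; ∉⊥)
open import Data.Fin.Subset.Induction using (⊂-wellFounded; ⊃-wellFounded)
open import Induction.WellFounded using (Acc; acc)
import Relation.Binary.Construct.On as On
open import Function.Base using (_on_)
open import Data.List using (List; []; _∷_; length; lookup; _ʳ++_; reverse)
open import Data.List.Relation.Unary.All as All using (All; []; _∷_)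
open import Data.List.Membership.Propositional.Properties using (∈-lookup)
open import Data.Nat.Properties using (suc-injective)
open import Data.Product using (Σ; _×_; _,_; proj₁; proj₂)
open import Data.Sum using (_⊎_; inj₁; inj₂)
open import Data.Empty using (⊥; ⊥-elim)
open import Data.Unit using (⊤; tt)
open import Function.Definitions using (Injective)
open import Relation.Nullary using (¬_; Dec; yes; no; does)
import Data.Vec as Vec
open import Data.Vec.Properties using (lookup⇒[]=; []=⇒lookup; lookup∘tabulate)
open import Relation.Nullary.Decidable using (_⊎-dec_; _→-dec_; _×-dec_; ¬?; map′; dec-true)
open import Relation.Unary using (Decidable)
open import Relation.Binary.PropositionalEquality using (_≡_; _≢_; refl; sym; trans; cong; subst; module ≡-Reasoning)
open import Function.Bundles using (_⇔_; mk⇔)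

⟦_⟧ : ∀ {m} {P : Fin m → Set} → Decidable P → Subset m
⟦ P? ⟧ = Vec.tabulate (λ x → does (P? x))

∈⟦⟧⁺ : ∀ {m} {P : Fin m → Set} (P? : Decidable P) {x} → P x → x ∈ ⟦ P? ⟧
∈⟦⟧⁺ P? {x} px = lookup⇒[]= x _ (trans (lookup∘tabulate _ x) (dec-true (P? x) px))

∈⟦⟧⁻ : ∀ {m} {P : Fin m → Set} (P? : Decidable P) {x} → x ∈ ⟦ P? ⟧ → P x
∈⟦⟧⁻ P? {x} x∈ with P? x | trans (sym (lookup∘tabulate (λ y → does (P? y)) x)) ([]=⇒lookup x∈)
... | yes px | _  = px
... | no _   | ()

find-counterexample : ∀ {m} {A B : Fin m → Set} → Decidable A → Decidable B →
                      ¬ (∀ x → A x → B x) → Σ (Fin m) λ x → A x × ¬ B x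
find-counterexample {m} A? B? ¬A⊆B
  with ¬∀⟶∃¬ m _ (λ x → A? x →-dec B? x) ¬A⊆B
... | x , ¬A⇒B with A? x
...   | yes a = x , a , λ b → ¬A⇒B (λ _ → b)
...   | no ¬a = ⊥-elim (¬A⇒B (λ a → ⊥-elim (¬a a)))

module Basics {n : ℕ} (G : Graph n) where
  open Graph G using (adj; irrefl)

  E? : ∀ x y → Dec (E G x y)
  E? x y = adj x y ≟ᵇ true

  E-sym : ∀ {x y} → E G x y → E G y x
  E-sym {x} {y} e = trans (Graph.sym G y x) e

  E-irrefl : ∀ {x y} → E G x y → x ≢ y
  E-irrefl {x} e refl with trans (sym (irrefl x)) e
  ... | ()

  CN? : ∀ x y → Dec (CN G x y)
  CN? x y = (x ≟ᶠ y) ⊎-dec E? x y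

  CN-sym : ∀ {x y} → CN G x y → CN G y x
  CN-sym (inj₁ refl) = inj₁ refl
  CN-sym (inj₂ e)    = inj₂ (E-sym e)

  CN⇒E : ∀ {x y} → CN G x y → x ≢ y → E G x y
  CN⇒E (inj₁ x≡y) x≢y = ⊥-elim (x≢y x≡y)
  CN⇒E (inj₂ e)   _   = e

  Far : Fin n → Fin n → Set
  Far x y = x ≢ y × ¬ E G x y

  Far-sym : ∀ {x y} → Far x y → Far y x
  Far-sym (x≢y , ¬e) = (λ y≡x → x≢y (sym y≡x)) , (λ e → ¬e (E-sym e))

  ¬CN⇒Far : ∀ {x y} → ¬ CN G x y → Far x y
  ¬CN⇒Far ¬c = (λ x≡y → ¬c (inj₁ x≡y)) , (λ e → ¬c (inj₂ e))

  Far⇒¬CN : ∀ {x y} → Far x y → ¬ CN G x y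
  Far⇒¬CN (x≢y , _)  (inj₁ x≡y) = x≢y x≡y
  Far⇒¬CN (_   , ¬e) (inj₂ e)   = ¬e e

  InCN? : ∀ D y → Dec (InCN G D y)
  InCN? D y = any? (λ x → (x ∈? D) ×-dec CN? x y)

  InON? : ∀ D y → Dec (InON G D y)
  InON? D y = InCN? D y ×-dec ¬? (y ∈? D)

  dominates-all? : ∀ D → Dec (Dominates G D (AllV G))
  dominates-all? D = map′ (λ dom y _ → dom y) (λ dom y → dom y tt) (all? (InCN? D))

  Priv? : ∀ D x u → Dec (Priv G D x u)
  Priv? D x u = CN? u x ×-dec all? (λ y → (y ∈? D) →-dec (CN? u y →-dec (y ≟ᶠ x)))

  NbhdSub? : ∀ x y → Dec (NbhdSub G x y)
  NbhdSub? x y = all? (λ z → CN? x z →-dec CN? y z)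

  reach-mono : ∀ {S S′ a b} → SubsetOf G S S′ → ReachIn G S a b → ReachIn G S′ a b
  reach-mono S⊆S′ here              = here
  reach-mono S⊆S′ (step e y∈S walk) = step e (S⊆S′ _ y∈S) (reach-mono S⊆S′ walk)

  reach-snoc : ∀ {S a b c} → ReachIn G S a b → E G b c → c ∈ S → ReachIn G S a c
  reach-snoc here              e c∈S = step e c∈S here
  reach-snoc (step e′ y∈S walk) e c∈S = step e′ y∈S (reach-snoc walk e c∈S)

  reach-++ : ∀ {S a b c} → ReachIn G S a b → ReachIn G S b c → ReachIn G S a c
  reach-++ here              walk′ = walk′
  reach-++ (step e y∈S walk) walk′ = step e y∈S (reach-++ walk walk′)

  reach-reverse : ∀ {S a b} → ReachIn G S a b → a ∈ S → ReachIn G S b a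
  reach-reverse here              _   = here
  reach-reverse (step e y∈S walk) a∈S = reach-snoc (reach-reverse walk y∈S) (E-sym e) a∈S

  frontier-edge : ∀ {S x a b} → ReachIn G S a b → a ∈ S → E G x a → ¬ CN G x b →
    Σ (Fin n) λ p → Σ (Fin n) λ v → p ∈ S × v ∈ S × E G x p × E G p v × ¬ E G x v
  frontier-edge here _ exa ¬xb = ⊥-elim (¬xb (inj₂ exa))
  frontier-edge {x = x} (step {y = y} e y∈S walk) a∈S exa ¬xb with E? x y
  ... | yes exy = frontier-edge walk y∈S exy ¬xb
  ... | no ¬exy = _ , y , a∈S , y∈S , exa , e , ¬exy

module InducedPaths {n : ℕ} (G : Graph n) where
  open Basics G

  FarAll : Fin n → List (Fin n) → Set
  FarAll v = All (Far v)

  Separated : List (Fin n) → List (Fin n) → Set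
  Separated ps qs = All (λ p → FarAll p qs) ps

  Path : List (Fin n) → Set
  Path []           = ⊤
  Path (v ∷ [])     = ⊤
  Path (v ∷ w ∷ ws) = E G v w × FarAll v ws × Path (w ∷ ws)

  transpose-head : ∀ {q ps qs} → Separated ps (q ∷ qs) → FarAll q ps
  transpose-head = All.map (λ far → Far-sym (All.head far))

  glue : ∀ {q} ps qs → Path (q ∷ ps) → Path (q ∷ qs) → Separated ps qs →
         Path (ps ʳ++ (q ∷ qs))
  glue []       qs _                      path-q _   = path-q
  glue (p ∷ ps) qs (eqp , qfar , path-p) path-q (pfar ∷ sep) =
    glue ps (_ ∷ qs) path-p (E-sym eqp , pfar , path-q)
         (All.zipWith (λ (f , row) → Far-sym f ∷ row) (qfar , sep))

  path-reverse : ∀ vs → Path vs → Path (reverse vs)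
  path-reverse []       _    = tt
  path-reverse (q ∷ ps) path = glue ps [] path tt (All.universal (λ _ → []) ps)

  farAt : ∀ {v ws} → FarAll v ws → (j : Fin (length ws)) → Far v (lookup ws j)
  farAt fs j = All.lookup fs (∈-lookup j)

  path-injective : ∀ vs → Path vs → ∀ i j → lookup vs i ≡ lookup vs j → i ≡ j
  path-injective (v ∷ [])     _                  zero    zero    _ = refl
  path-injective (v ∷ w ∷ ws) _                  zero    zero    _ = refl
  path-injective (v ∷ w ∷ ws) (e , _ , _)        zero    (suc zero) eq = ⊥-elim (E-irrefl e eq)
  path-injective (v ∷ w ∷ ws) (_ , far , _)      zero    (suc (suc j)) eq = ⊥-elim (proj₁ (farAt far j) eq)
  path-injective (v ∷ w ∷ ws) (e , _ , _)        (suc zero) zero eq = ⊥-elim (E-irrefl e (sym eq))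
  path-injective (v ∷ w ∷ ws) (_ , far , _)      (suc (suc i)) zero eq = ⊥-elim (proj₁ (farAt far i) (sym eq))
  path-injective (v ∷ w ∷ ws) (_ , _ , path)     (suc i) (suc j) eq = cong suc (path-injective (w ∷ ws) path i j eq)

  PathAdj-suc : ∀ {k} {i j : Fin k} → PathAdj G i j → PathAdj G (suc i) (suc j)
  PathAdj-suc (inj₁ eq) = inj₁ (cong suc eq)
  PathAdj-suc (inj₂ eq) = inj₂ (cong suc eq)

  PathAdj-pred : ∀ {k} {i j : Fin k} → PathAdj G (suc i) (suc j) → PathAdj G i j
  PathAdj-pred (inj₁ eq) = inj₁ (suc-injective eq)
  PathAdj-pred (inj₂ eq) = inj₂ (suc-injective eq)

  path-adjacency : ∀ vs → Path vs → ∀ i j →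
    (E G (lookup vs i) (lookup vs j) → PathAdj G i j) × (PathAdj G i j → E G (lookup vs i) (lookup vs j))
  path-adjacency (v ∷ [])     _ zero zero = (λ e → ⊥-elim (E-irrefl e refl)) , λ { (inj₁ ()) ; (inj₂ ()) }
  path-adjacency (v ∷ w ∷ ws) _ zero zero = (λ e → ⊥-elim (E-irrefl e refl)) , λ { (inj₁ ()) ; (inj₂ ()) }
  path-adjacency (v ∷ w ∷ ws) (e , _ , _) zero (suc zero) = (λ _ → inj₁ refl) , (λ _ → e)
  path-adjacency (v ∷ w ∷ ws) (e , _ , _) (suc zero) zero = (λ _ → inj₂ refl) , (λ _ → E-sym e)
  path-adjacency (v ∷ w ∷ ws) (_ , far , _) zero (suc (suc j)) =
    (λ e → ⊥-elim (proj₂ (farAt far j) e)) , λ { (inj₁ ()) ; (inj₂ ()) }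
  path-adjacency (v ∷ w ∷ ws) (_ , far , _) (suc (suc i)) zero =
    (λ e → ⊥-elim (proj₂ (farAt far i) (E-sym e))) , λ { (inj₁ ()) ; (inj₂ ()) }
  path-adjacency (v ∷ w ∷ ws) (_ , _ , path) (suc i) (suc j) =
    let (to , from) = path-adjacency (w ∷ ws) path i j
    in (λ e → PathAdj-suc (to e)) , (λ adj → from (PathAdj-pred adj))

  path-embedding : ∀ vs → Path vs → Σ (Fin (length vs) → Fin n) λ v →
    Injective _≡_ _≡_ v × (∀ i j → (E G (v i) (v j) → PathAdj G i j) × (PathAdj G i j → E G (v i) (v j)))
  path-embedding vs path = lookup vs , (λ {i} {j} → path-injective vs path i j) , path-adjacency vs path

  SeesLast : Fin n → List (Fin n) → Set
  SeesLast z []            = ⊥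
  SeesLast z (w ∷ [])      = E G z w
  SeesLast z (w ∷ w' ∷ ws) = Far z w × SeesLast z (w' ∷ ws)

  SeesLast-at : ∀ {z} ws → SeesLast z ws → ∀ j →
    z ≢ lookup ws j × (E G z (lookup ws j) → suc (toℕ j) ≡ length ws) × (suc (toℕ j) ≡ length ws → E G z (lookup ws j))
  SeesLast-at (w ∷ [])      e               zero    = E-irrefl e , (λ _ → refl) , (λ _ → e)
  SeesLast-at (w ∷ w' ∷ ws) ((z≢w , ¬e) , _) zero    = z≢w , (λ e → ⊥-elim (¬e e)) , (λ ())
  SeesLast-at (w ∷ w' ∷ ws) (_ , sees)      (suc j) =
    let (z≢ , to , from) = SeesLast-at (w' ∷ ws) sees j
    in z≢ , (λ e → cong suc (to e)) , (λ eq → from (suc-injective eq))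

  closing-cycle : ∀ {z w} ws → Path (w ∷ ws) → E G z w → SeesLast z ws →
                  InducedCycle G (suc (suc (length ws)))
  closing-cycle {z} {w} ws path ezw sees =
    lookup (z ∷ w ∷ ws) , (λ {i} {j} → injective i j) , adjacency
    where
    L = w ∷ ws
    k = suc (length L)

    EndIndex : Fin (length L) → Set
    EndIndex j = toℕ j ≡ 0 ⊎ suc (toℕ j) ≡ length L

    ends : ∀ j → z ≢ lookup L j × (E G z (lookup L j) → EndIndex j) × (EndIndex j → E G z (lookup L j))
    ends zero    = E-irrefl ezw , (λ _ → inj₁ refl) , (λ _ → ezw)
    ends (suc j) =
      let (z≢ , to , from) = SeesLast-at ws sees j
      in z≢ , (λ e → inj₂ (cong suc (to e))) , λ { (inj₁ ()) ; (inj₂ eq) → from (suc-injective eq) }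

    injective : ∀ i j → lookup (z ∷ L) i ≡ lookup (z ∷ L) j → i ≡ j
    injective zero    zero    _  = refl
    injective zero    (suc j) eq = ⊥-elim (proj₁ (ends j) eq)
    injective (suc i) zero    eq = ⊥-elim (proj₁ (ends i) (sym eq))
    injective (suc i) (suc j) eq = cong suc (path-injective L path i j eq)

    to-zero : ∀ j → EndIndex j → CycAdj G k zero (suc j)
    to-zero j (inj₁ eq) = inj₁ (inj₁ (cong suc eq))
    to-zero j (inj₂ eq) = inj₂ (inj₁ (refl , cong suc eq))

    from-zero : ∀ j → CycAdj G k zero (suc j) → EndIndex j
    from-zero j (inj₁ (inj₁ eq))      = inj₁ (suc-injective eq)
    from-zero j (inj₂ (inj₁ (_ , eq))) = inj₂ (suc-injective eq)

    flip-adj : ∀ {i j} → CycAdj G k i j → CycAdj G k j i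
    flip-adj (inj₁ (inj₁ eq)) = inj₁ (inj₂ eq)
    flip-adj (inj₁ (inj₂ eq)) = inj₁ (inj₁ eq)
    flip-adj (inj₂ (inj₁ eq)) = inj₂ (inj₂ eq)
    flip-adj (inj₂ (inj₂ eq)) = inj₂ (inj₁ eq)

    adjacency : ∀ i j → (E G (lookup (z ∷ L) i) (lookup (z ∷ L) j) → CycAdj G k i j) ×
                        (CycAdj G k i j → E G (lookup (z ∷ L) i) (lookup (z ∷ L) j))
    adjacency zero zero = (λ e → ⊥-elim (E-irrefl e refl)) ,
      λ { (inj₁ (inj₁ ())) ; (inj₁ (inj₂ ())) ; (inj₂ (inj₁ (_ , ()))) ; (inj₂ (inj₂ (_ , ()))) }
    adjacency zero (suc j) =
      let (_ , to , from) = ends j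
      in (λ e → to-zero j (to e)) , (λ adj → from (from-zero j adj))
    adjacency (suc i) zero =
      let (_ , to , from) = ends i
      in (λ e → flip-adj (to-zero i (to (E-sym e)))) , (λ adj → E-sym (from (from-zero i (flip-adj adj))))
    adjacency (suc i) (suc j) =
      let (to , from) = path-adjacency L path i j
      in (λ e → inj₁ (PathAdj-suc (to e))) ,
         λ { (inj₁ adj) → from (PathAdj-pred adj) ; (inj₂ (inj₁ (() , _))) ; (inj₂ (inj₂ (() , _))) }

module Chordality {n : ℕ} (G : Graph n) where
  open Basics G
  open InducedPaths G

  -- Then z is far from
  -- all of qs: the first neighbour of z on qs would close an induced cycle of
  -- length at least four, and z itself cannot lie on qs since it is far from q.
  chordal-far : Chordal G → ∀ {z q p} ps qs → Path (q ∷ p ∷ ps) → Path (q ∷ qs) →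
                Separated (p ∷ ps) qs → SeesLast z (q ∷ p ∷ ps) → FarAll z qs
  chordal-far ch ps []       _      _                          _   _ = []
  chordal-far ch {z} {q} {p} ps (b ∷ qs) path-p (eqb , qfar , path-b) sep sees@(fzq , _)
    with E? z b | z ≟ᶠ b
  ... | yes ezb | _ = ⊥-elim (ch _ (s≤s (s≤s (s≤s (s≤s z≤n))))
                               (closing-cycle (q ∷ p ∷ ps) (E-sym eqb , transpose-head sep , path-p) ezb sees))
  ... | no _    | yes refl = ⊥-elim (proj₂ fzq (E-sym eqb))
  ... | no ¬ezb | no z≢b   =
    (z≢b , ¬ezb) ∷ chordal-far ch (p ∷ ps) qs (E-sym eqb , transpose-head sep , path-p) path-b
                                (qfar ∷ All.map All.tail sep) ((z≢b , ¬ezb) , sees)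

  paths-apart : Chordal G → ∀ {x a b} as bs → Path (x ∷ a ∷ as) → Path (x ∷ b ∷ bs) →
                Far a b → Separated (a ∷ as) (b ∷ bs)
  paths-apart ch {x} {a} {b} as bs (exa , xfar , path-a) path-b@(exb , xfar′ , path-b′) fab =
    row ∷ rest as path-a xfar
    where
    row : FarAll a (b ∷ bs)
    row = fab ∷ chordal-far ch [] bs (E-sym exb , [] , tt) path-b′ (xfar′ ∷ []) (fab , E-sym exa)

    -- Re-rooting at a: the path a·x·b·bs is induced, so the remaining
    -- vertices of the first path are handled recursively.
    rest : ∀ as → Path (a ∷ as) → FarAll x as → Separated as (b ∷ bs)
    rest []         _      _    = []
    rest (a′ ∷ as′) path-a xfar =
      All.map All.tail (paths-apart ch as′ (b ∷ bs) path-a (E-sym exa , row , path-b)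
                                    (Far-sym (All.head xfar)))

  chordal-glue : Chordal G → ∀ {x a b} as bs → Path (x ∷ a ∷ as) → Path (x ∷ b ∷ bs) →
                 Far a b → Path ((a ∷ as) ʳ++ (x ∷ b ∷ bs))
  chordal-glue ch as bs path-a path-b fab =
    glue (_ ∷ as) (_ ∷ bs) path-a path-b (paths-apart ch as bs path-a path-b fab)

  record Arm (x : Fin n) (C : Subset n) : Set where
    field
      a₁ a₂ a₃ a₄ : Fin n
      a₁∈C        : a₁ ∈ C
      path        : Path (x ∷ a₁ ∷ a₂ ∷ a₃ ∷ a₄ ∷ [])

  no-two-arms : Chordal G → P9Free G → ∀ {x C D} (α : Arm x C) (β : Arm x D) →
                Far (Arm.a₁ α) (Arm.a₁ β) → ⊥
  no-two-arms ch p9 α β far =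
    p9 (path-embedding _ (chordal-glue ch (a₂ ∷ a₃ ∷ a₄ ∷ []) (b₂ ∷ b₃ ∷ b₄ ∷ []) α.path β.path far))
    where
    module α = Arm α
    module β = Arm β
    open Arm α using (a₂; a₃; a₄)
    open Arm β using () renaming (a₂ to b₂; a₃ to b₃; a₄ to b₄)

module Domination {n : ℕ} (G : Graph n) where
  open Basics G

  dominates-mono : ∀ {D D′ X} → SubsetOf G D D′ → Dominates G D X → Dominates G D′ X
  dominates-mono D⊆D′ dom y y∈X =
    let (d , d∈D , dy) = dom y y∈X in d , D⊆D′ d d∈D , dy

  minimal-dominating-subset : ∀ D → Dominates G D (AllV G) →
    Σ (Subset n) λ D′ → SubsetOf G D′ D × MinimalDominating G D′
  minimal-dominating-subset D = shrink D (⊂-wellFounded D)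
    where
    shrink : ∀ D → Acc _⊂_ D → Dominates G D (AllV G) →
             Σ (Subset n) λ D′ → SubsetOf G D′ D × MinimalDominating G D′
    shrink D (acc smaller) dom with any? (λ z → (z ∈? D) ×-dec dominates-all? (D - z))
    ... | yes (z , z∈D , dom-z) =
      let (D′ , D′⊆D-z , minimal) = shrink (D - z) (smaller (x∈p⇒p-x⊂p z∈D)) dom-z
      in D′ , (λ x x∈D′ → p─q⊆p D ⁅ z ⁆ (D′⊆D-z x x∈D′)) , minimal
    ... | no irreducible = D , (λ _ x∈D → x∈D) , dom , minimal
      where
      minimal : ∀ D′ → SubsetOf G D′ D → Dominates G D′ (AllV G) → SubsetOf G D D′
      minimal D′ D′⊆D dom′ x x∈D with x ∈? D′
      ... | yes x∈D′ = x∈D′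
      ... | no x∉D′  = ⊥-elim (irreducible (x , x∈D , dominates-mono D′⊆D-x dom′))
        where
        D′⊆D-x : SubsetOf G D′ (D - x)
        D′⊆D-x y y∈D′ = x∈p∧x≢y⇒x∈p-y (D′⊆D y y∈D′) (λ y≡x → x∉D′ (subst (_∈ D′) y≡x y∈D′))

  private-survives : ∀ {D D′ x u} → SubsetOf G D′ D → Dominates G D′ (AllV G) →
                     Priv G D x u → x ∈ D′
  private-survives D′⊆D dom (_ , unique) =
    let (d , d∈D′ , du) = dom _ tt
    in subst (_∈ _) (unique d (D′⊆D d d∈D′) (CN-sym du)) d∈D′

  -- Every vertex of a minimal dominating set has a private neighbour:
  -- otherwise dropping it would leave a dominating set.
  minimal⇒private : ∀ {D x} → MinimalDominating G D → x ∈ D → Σ (Fin n) λ u → Priv G D x u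
  minimal⇒private {D} {x} (dom , minimal) x∈D
    with find-counterexample (λ _ → yes tt) (InCN? (D - x)) D-x-dominates
    where
    D-x-dominates : ¬ (∀ t → ⊤ → InCN G (D - x) t)
    D-x-dominates dom′ =
      let (D-x⊆D , y , y∈D , y∉D-x) = x∈p⇒p-x⊂p {p = D} x∈D
      in y∉D-x (minimal (D - x) (λ z z∈ → D-x⊆D z∈) (λ t _ → dom′ t tt) y y∈D)
  ... | t , _ , ¬dom-t with dom t tt
  ...   | d , d∈D , dt = t , subst (CN G t) (only-x d d∈D (CN-sym dt)) (CN-sym dt) , only-x
    where
    only-x : ∀ y → y ∈ D → CN G t y → y ≡ x
    only-x y y∈D ty with y ≟ᶠ x
    ... | yes y≡x = y≡x
    ... | no y≢x  = ⊥-elim (¬dom-t (y , x∈p∧x≢y⇒x∈p-y y∈D y≢x , CN-sym ty))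

  private-below : ∀ {D x t y} → Dominates G D (AllV G) → Priv G D x t → NbhdSub G y t →
                  Priv G D x y
  private-below {D} dom (_ , unique) y⊆t =
    let (d , d∈D , dy) = dom _ tt
        only-x : ∀ z → z ∈ D → CN G _ z → z ≡ _
        only-x z z∈D yz = unique z z∈D (y⊆t z yz)
    in subst (CN G _) (only-x d d∈D (CN-sym dy)) (CN-sym dy) , only-x

  private-antitone : ∀ {A D x u} → SubsetOf G A D → Priv G D x u → Priv G A x u
  private-antitone A⊆D (ux , only-x) = ux , λ y y∈A uy → only-x y (A⊆D y y∈A) uy

module Components {n : ℕ} (G : Graph n) (I : Subset n) where
  open Basics G

  walk-stays : ∀ {S C a b} → IsComponentOf G I C → ReachIn G S a b → SubsetOf G S I → a ∈ C → b ∈ C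
  walk-stays comp here              _   a∈C = a∈C
  walk-stays comp (step e y∈S walk) S⊆I a∈C =
    walk-stays comp walk S⊆I (IsComponentOf.closed comp _ _ a∈C (S⊆I _ y∈S) e)

  component-closed : ∀ {C u y} → IsComponentOf G I C → u ∈ C → CN G u y → y ∈ I → y ∈ C
  component-closed comp u∈C (inj₁ refl) _   = u∈C
  component-closed comp u∈C (inj₂ e)    y∈I = IsComponentOf.closed comp _ _ u∈C y∈I e

  component-unique : ∀ {C C′ z} → IsComponentOf G I C → IsComponentOf G I C′ → z ∈ C → z ∈ C′ → C ≡ C′
  component-unique comp comp′ z∈C z∈C′ = ⊆-antisym (included comp comp′ z∈C z∈C′) (included comp′ comp z∈C′ z∈C)
    where
    included : ∀ {C C′ z} → IsComponentOf G I C → IsComponentOf G I C′ → z ∈ C → z ∈ C′ → C ⊆ C′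
    included comp comp′ z∈C z∈C′ x∈C =
      walk-stays comp′ (IsComponentOf.connected comp _ _ z∈C x∈C) (IsComponentOf.inside comp) z∈C′

  PartlySees : Fin n → Subset n → Set
  PartlySees x C = (Σ (Fin n) λ p → p ∈ C × E G x p) × (Σ (Fin n) λ w → w ∈ C × ¬ CN G x w)

  component-exists : ∀ y → y ∈ I → Σ (Subset n) λ C → IsComponentOf G I C × y ∈ C
  component-exists y y∈I = grow ⁅ y ⁆ (⊃-wellFounded _) singleton⊆I (x∈⁅x⁆ y) from-y
    where
    singleton⊆I : SubsetOf G ⁅ y ⁆ I
    singleton⊆I z z∈ = subst (_∈ I) (sym (x∈⁅y⁆⇒x≡y y z∈)) y∈I

    from-y : ∀ z → z ∈ ⁅ y ⁆ → ReachIn G ⁅ y ⁆ y z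
    from-y z z∈ = subst (ReachIn G ⁅ y ⁆ y) (sym (x∈⁅y⁆⇒x≡y y z∈)) here

    grow : ∀ C → Acc _⊃_ C → SubsetOf G C I → y ∈ C → (∀ z → z ∈ C → ReachIn G C y z) →
           Σ (Subset n) λ C → IsComponentOf G I C × y ∈ C
    grow C (acc larger) C⊆I y∈C reach
      with any? (λ s → any? (λ t → (s ∈? C) ×-dec (t ∈? I) ×-dec ¬? (t ∈? C) ×-dec E? s t))
    ... | no no-exit = C , component , y∈C
      where
      closed : ∀ x t → x ∈ C → t ∈ I → E G x t → t ∈ C
      closed x t x∈C t∈I e with t ∈? C
      ... | yes t∈C = t∈C
      ... | no t∉C  = ⊥-elim (no-exit (x , t , x∈C , t∈I , t∉C , e))

      component : IsComponentOf G I C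
      component = record
        { nonempty  = y , y∈C
        ; inside    = C⊆I
        ; connected = λ a b a∈C b∈C → reach-++ (reach-reverse (reach a a∈C) y∈C) (reach b b∈C)
        ; closed    = closed }
    ... | yes (s , t , s∈C , t∈I , t∉C , est) =
      grow C+t (larger (C⊆C+t , t , t∈C+t , t∉C)) C+t⊆I (C⊆C+t y∈C) reach+t
      where
      C+t = C ∪ ⁅ t ⁆

      C⊆C+t : C ⊆ C+t
      C⊆C+t = p⊆p∪q ⁅ t ⁆

      t∈C+t : t ∈ C+t
      t∈C+t = x∈p∪q⁺ (inj₂ (x∈⁅x⁆ t))

      C+t⊆I : SubsetOf G C+t I
      C+t⊆I z z∈ with x∈p∪q⁻ C ⁅ t ⁆ z∈
      ... | inj₁ z∈C = C⊆I z z∈C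
      ... | inj₂ z∈t = subst (_∈ I) (sym (x∈⁅y⁆⇒x≡y t z∈t)) t∈I

      reach+t : ∀ z → z ∈ C+t → ReachIn G C+t y z
      reach+t z z∈ with x∈p∪q⁻ C ⁅ t ⁆ z∈
      ... | inj₁ z∈C = reach-mono (λ _ → C⊆C+t) (reach z z∈C)
      ... | inj₂ z∈t = subst (ReachIn G C+t y) (sym (x∈⁅y⁆⇒x≡y t z∈t))
                             (reach-snoc (reach-mono (λ _ → C⊆C+t) (reach s s∈C)) est t∈C+t)

module Irredundant {n : ℕ} (G : Graph n) (I : Subset n) (isIR : IsIRChoice G I) where
  open IsIRChoice isIR
  open Basics G
  open InducedPaths G
  open Chordality G
  open Domination G
  open Components G I

  escape : ∀ {u w t} → MinNbhd G u → E G u w → CN G u t → ¬ CN G w t →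
           Σ (Fin n) λ y → E G w y × Far u y
  escape {u} {w} minimal euw ut ¬wt
    with find-counterexample (CN? w) (CN? u) (λ w⊆u → ¬wt (minimal w w⊆u _ ut))
  ... | y , wy , ¬uy = y , CN⇒E wy (λ w≡y → ¬uy (subst (CN G u) w≡y (inj₂ euw))) , ¬CN⇒Far ¬uy

  N[_] : Fin n → Subset n
  N[ t ] = ⟦ CN? t ⟧

  irredundant-below : ∀ t → Σ (Fin n) λ y → y ∈ I × NbhdSub G y t
  irredundant-below t = descend t (On.wellFounded N[_] ⊂-wellFounded t)
    where
    descend : ∀ t → Acc (_⊂_ on N[_]) t → Σ (Fin n) λ y → y ∈ I × NbhdSub G y t
    descend t (acc smaller) with all? (λ y → NbhdSub? y t →-dec NbhdSub? t y)
    ... | yes minimal = let (y , y∈I , _ , y⊆t) = some-rep t minimal in y , y∈I , y⊆t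
    ... | no ¬minimal with find-counterexample (λ y → NbhdSub? y t) (λ y → NbhdSub? t y) ¬minimal
    ...   | y , y⊆t , t⊈y =
      let (z , tz , ¬yz) = find-counterexample (CN? t) (CN? y) t⊈y
          N[y]⊂N[t] = (λ {w} w∈ → ∈⟦⟧⁺ (CN? t) (y⊆t w (∈⟦⟧⁻ (CN? y) w∈))) ,
                      z , ∈⟦⟧⁺ (CN? t) tz , (λ z∈ → ¬yz (∈⟦⟧⁻ (CN? y) z∈))
          (y′ , y′∈I , y′⊆y) = descend y (smaller N[y]⊂N[t])
      in y′ , y′∈I , λ w y′w → y⊆t w (y′⊆y w y′w)

  redundant-far : ∀ {x v} → x ∉ I → v ∈ I → ¬ E G x v → Far x v
  redundant-far x∉I v∈I ¬exv = (λ x≡v → x∉I (subst (_∈ I) (sym x≡v) v∈I)) , ¬exv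

  -- An edge p v of I with x ~ p and x ≁ v extends to an arm x p v r s of x:
  -- minimality of N[p] yields r ∈ N(v) far from p, minimality of N[v] yields
  -- s ∈ N(r) far from v, and chordality makes each extension induced.
  arm-from-edge : Chordal G → ∀ {x p v C} → x ∉ I → p ∈ C → p ∈ I → v ∈ I →
                  E G x p → E G p v → ¬ E G x v → Arm x C
  arm-from-edge ch {x} {p} {v} x∉I p∈C p∈I v∈I exp epv ¬exv
    with escape (only-minimal p p∈I) epv (inj₂ (E-sym exp)) (Far⇒¬CN (Far-sym far-xv))
    where far-xv = redundant-far x∉I v∈I ¬exv
  ... | r , evr , far-pr
    with escape (only-minimal v v∈I) evr (inj₂ (E-sym epv)) (Far⇒¬CN (Far-sym far-pr))
  ... | s , ers , far-vs =
    record { a₁ = p ; a₂ = v ; a₃ = r ; a₄ = s ; a₁∈C = p∈C ; path = path-xpvrs }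
    where
    path-xpv : Path (x ∷ p ∷ v ∷ [])
    path-xpv = chordal-glue ch [] [] (E-sym exp , [] , tt) (epv , [] , tt) (redundant-far x∉I v∈I ¬exv)

    path-xpvr : Path (x ∷ p ∷ v ∷ r ∷ [])
    path-xpvr = chordal-glue ch (x ∷ []) [] (path-reverse _ path-xpv) (evr , [] , tt) far-pr

    path-xpvrs : Path (x ∷ p ∷ v ∷ r ∷ s ∷ [])
    path-xpvrs = chordal-glue ch (p ∷ x ∷ []) [] (path-reverse _ path-xpvr) (ers , [] , tt) far-vs

  make-arm : Chordal G → ∀ {x C} → x ∉ I → IsComponentOf G I C → PartlySees x C → Arm x C
  make-arm ch x∉I comp ((p₀ , p₀∈C , exp₀) , (w , w∈C , ¬xw)) =
    let (p , v , p∈C , v∈C , exp , epv , ¬exv) =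
          frontier-edge (IsComponentOf.connected comp p₀ w p₀∈C w∈C) p₀∈C exp₀ ¬xw
    in arm-from-edge ch x∉I p∈C (inside p p∈C) (inside v v∈C) exp epv ¬exv
    where inside = IsComponentOf.inside comp

  -- Structural core: in a P₉-free chordal graph a redundant vertex cannot
  -- partly see two different irredundant components, since their arms
  -- would glue into an induced P₉.
  no-two-partial-components : Chordal G → P9Free G → ∀ {x C C′} → x ∉ I →
    IsComponentOf G I C → IsComponentOf G I C′ → C ≢ C′ → PartlySees x C → PartlySees x C′ → ⊥
  no-two-partial-components ch p9 x∉I comp comp′ C≢C′ sees sees′ =
    no-two-arms ch p9 α β (¬CN⇒Far apart)
    where
    α = make-arm ch x∉I comp sees
    β = make-arm ch x∉I comp′ sees′
    apart : ¬ CN G (Arm.a₁ α) (Arm.a₁ β)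
    apart ab = C≢C′ (component-unique comp comp′
      (component-closed comp (Arm.a₁∈C α) ab (IsComponentOf.inside comp′ _ (Arm.a₁∈C β)))
      (Arm.a₁∈C β))

  -- Every vertex of a minimal dominating set has an irredundant private
  -- neighbour: push any private neighbour down to an irredundant vertex.
  irredundant-private : ∀ {D x} → MinimalDominating G D → x ∈ D → Σ (Fin n) λ u → PrivIR G I D x u
  irredundant-private md x∈D =
    let (t , priv) = minimal⇒private md x∈D
        (y , y∈I , y⊆t) = irredundant-below t
    in y , private-below (proj₁ md) priv y⊆t , y∈I

  dominates-IR⇒dominates : ∀ {D} → (∀ y → y ∈ I → InCN G D y) → Dominates G D (AllV G)
  dominates-IR⇒dominates covers t _ =
    let (y , y∈I , y⊆t) = irredundant-below t
        (d , d∈D , dy) = covers y y∈I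
    in d , d∈D , CN-sym (y⊆t d (CN-sym dy))

module Characterisation {n : ℕ} (G : Graph n) (I : Subset n) (isIR : IsIRChoice G I)
                        (A : Subset n) (A⊆RN : ∀ x → x ∈ A → x ∉ I) where
  open Basics G
  open Domination G
  open Components G I
  open Irredundant G I isIR

  Admissible : Subset n → Subset n → Set
  Admissible C D = SubsetOf G D C × Dominates G D (λ y → y ∈ C × ¬ InON G A y) ×
                   (∀ x → InRi G I A C x → ¬ Dominates G D (PrivIR G I A x))

  Conditions : Set
  Conditions = (∀ a → a ∈ A → Σ (Fin n) λ u → PrivIR G I A a u) ×
               (∀ C → IsComponentOf G I C → Σ (Subset n) λ D → Admissible C D)

  module Necessity (D : Subset n) (md : MinimalDominating G D)
                   (D∩RN≡A : ∀ x → (x ∈ A → x ∈ D × x ∉ I) × (x ∈ D × x ∉ I → x ∈ A)) where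

    A⊆D : SubsetOf G A D
    A⊆D a a∈A = proj₁ (proj₁ (D∩RN≡A a) a∈A)

    private-in-A : ∀ a → a ∈ A → Σ (Fin n) λ u → PrivIR G I A a u
    private-in-A a a∈A =
      let (u , priv , u∈I) = irredundant-private md (A⊆D a a∈A)
      in u , private-antitone A⊆D priv , u∈I

    -- A vertex of C outside N(A) is dominated by D, necessarily from I and
    -- hence from C itself.
    admissible : ∀ C → IsComponentOf G I C → Admissible C (D ∩ C)
    admissible C comp = (λ _ z∈ → proj₂ (x∈p∩q⁻ D C z∈)) , dominates , not-private
      where
      dominates : Dominates G (D ∩ C) (λ y → y ∈ C × ¬ InON G A y)
      dominates y (y∈C , y∉N[A]) with proj₁ md y tt
      ... | d , d∈D , dy with d ∈? I
      ...   | yes d∈I = d , x∈p∩q⁺ (d∈D , component-closed comp y∈C (CN-sym dy) d∈I) , dy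
      ...   | no d∉I  = ⊥-elim (y∉N[A] ((d , proj₂ (D∩RN≡A d) (d∈D , d∉I) , dy) ,
                                          λ y∈A → A⊆RN y y∈A (IsComponentOf.inside comp y y∈C)))

      -- The irredundant private neighbour u of x w.r.t. D is private w.r.t.
      -- A; a dominator of u in D ∩ C would be x itself, yet x ∉ I ⊇ C.
      not-private : ∀ x → InRi G I A C x → ¬ Dominates G (D ∩ C) (PrivIR G I A x)
      not-private x ((x∈A , _) , _) dom =
        let (u , (ux , only-x) , u∈I) = irredundant-private md (A⊆D x x∈A)
            (d , d∈D∩C , du) = dom u ((private-antitone A⊆D (ux , only-x)) , u∈I)
            (d∈D , d∈C) = x∈p∩q⁻ D C d∈D∩C
        in A⊆RN x x∈A (subst (_∈ I) (only-x d d∈D (CN-sym du)) (IsComponentOf.inside comp d d∈C))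

  -- Sufficiency: from irredundant private neighbours for A and admissible
  -- sets D_C, build D₀ = A ∪ ⋃_C D_C (using ∅ for components inside N(A)),
  -- check that every a ∈ A keeps a private neighbour w.r.t. D₀, and shrink
  -- D₀ to a minimal dominating set, which must still contain A.
  module Sufficiency (ch : Chordal G) (p9 : P9Free G)
                     (has-private : ∀ a → a ∈ A → Σ (Fin n) λ u → PrivIR G I A a u)
                     (admissible : ∀ C → IsComponentOf G I C → Σ (Subset n) λ D → Admissible C D) where

    -- The component of an irredundant vertex (∅ for redundant vertices).
    comp : Fin n → Subset n
    comp z with z ∈? I
    ... | yes z∈I = proj₁ (component-exists z z∈I)
    ... | no _    = ∅

    comp-spec : ∀ {z} → z ∈ I → IsComponentOf G I (comp z) × z ∈ comp z
    comp-spec {z} z∈I with z ∈? I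
    ... | yes z∈I′ = proj₂ (component-exists z z∈I′)
    ... | no z∉I   = ⊥-elim (z∉I z∈I)

    comp-same : ∀ {u d} → u ∈ I → d ∈ comp u → comp d ≡ comp u
    comp-same u∈I d∈ =
      let (comp-u , _) = comp-spec u∈I
          (comp-d , d∈′) = comp-spec (IsComponentOf.inside comp-u _ d∈)
      in component-unique comp-d comp-u d∈′ d∈

    Saturated : Subset n → Set
    Saturated C = ∀ y → y ∈ C → InON G A y

    saturated? : ∀ C → Dec (Saturated C)
    saturated? C = all? (λ y → (y ∈? C) →-dec InON? A y)

    record Fits (C D : Subset n) : Set where
      field
        within         : SubsetOf G D C
        when-open      : ¬ Saturated C → Admissible C D
        when-saturated : Saturated C → ∀ z → z ∉ D

    choose : (C : Subset n) → IsComponentOf G I C → Subset n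
    choose C comp-C with saturated? C
    ... | yes _ = ∅
    ... | no _  = proj₁ (admissible C comp-C)

    choose-fits : ∀ C comp-C → Fits C (choose C comp-C)
    choose-fits C comp-C with saturated? C
    ... | yes sat = record { within = λ _ z∈ → ⊥-elim (∉⊥ z∈) ; when-open = λ ¬sat → ⊥-elim (¬sat sat)
                           ; when-saturated = λ _ _ → ∉⊥ }
    ... | no ¬sat = let adm = proj₂ (admissible C comp-C)
                    in record { within = proj₁ adm ; when-open = λ _ → adm
                              ; when-saturated = λ sat → ⊥-elim (¬sat sat) }

    local : Fin n → Subset n
    local r with r ∈? I
    ... | yes r∈I = let (C , comp-C , _) = component-exists r r∈I in choose C comp-C
    ... | no _    = ∅

    local-fits : ∀ {r} → r ∈ I → Fits (comp r) (local r)
    local-fits {r} r∈I with r ∈? I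
    ... | yes _  = choose-fits _ _
    ... | no r∉I = ⊥-elim (r∉I r∈I)

    first-or : Subset n → Fin n → Fin n
    first-or C z with any? (_∈? C)
    ... | yes (r , _) = r
    ... | no _        = z

    first-or-∈ : ∀ {C x} z → x ∈ C → first-or C z ∈ C
    first-or-∈ {C} {x} z x∈C with any? (_∈? C)
    ... | yes (_ , r∈C) = r∈C
    ... | no empty      = ⊥-elim (empty (x , x∈C))

    first-or-default : ∀ {C x} y z → x ∈ C → first-or C y ≡ first-or C z
    first-or-default {C} {x} y z x∈C with any? (_∈? C)
    ... | yes _    = refl
    ... | no empty = ⊥-elim (empty (x , x∈C))

    -- The set chosen for the component of z, read off at the first vertex
    -- of that component so that all of its vertices agree on it.
    chosen : Fin n → Subset n
    chosen z = local (first-or (comp z) z)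

    chosen-coherent : ∀ {u d} → u ∈ I → d ∈ comp u → chosen d ≡ chosen u
    chosen-coherent {u} {d} u∈I d∈ = cong local (begin
      first-or (comp d) d ≡⟨ cong (λ C → first-or C d) (comp-same u∈I d∈) ⟩
      first-or (comp u) d ≡⟨ first-or-default d u (proj₂ (comp-spec u∈I)) ⟩
      first-or (comp u) u ∎)
      where open ≡-Reasoning

    chosen-fits : ∀ {u} → u ∈ I → Fits (comp u) (chosen u)
    chosen-fits {u} u∈I = subst (λ C → Fits C (chosen u)) (comp-same u∈I r∈) (local-fits r∈I)
      where
      r∈ = first-or-∈ u (proj₂ (comp-spec u∈I))
      r∈I = IsComponentOf.inside (proj₁ (comp-spec u∈I)) _ r∈

    member? : ∀ z → Dec (z ∈ A ⊎ (z ∈ I × z ∈ chosen z))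
    member? z = (z ∈? A) ⊎-dec ((z ∈? I) ×-dec (z ∈? chosen z))

    D₀ : Subset n
    D₀ = ⟦ member? ⟧

    -- Every irredundant vertex y is dominated by D₀: from A if y ∈ N[A],
    -- otherwise by the admissible set chosen for its (unsaturated) component.
    D₀-covers-IR : ∀ y → y ∈ I → InCN G D₀ y
    D₀-covers-IR y y∈I with InCN? A y
    ... | yes (a , a∈A , ay) = a , ∈⟦⟧⁺ member? (inj₁ a∈A) , ay
    ... | no ¬Ay =
      let open Fits (chosen-fits y∈I)
          (comp-y , y∈C) = comp-spec y∈I
          (_ , dominates , _) = when-open (λ sat → ¬Ay (proj₁ (sat y y∈C)))
          (d , d∈ , dy) = dominates y (y∈C , λ y∈N[A] → ¬Ay (proj₁ y∈N[A]))
          d∈C = within d d∈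
      in d , ∈⟦⟧⁺ member? (inj₂ (IsComponentOf.inside comp-y d d∈C ,
                                 subst (d ∈_) (sym (chosen-coherent y∈I d∈C)) d∈)) , dy

    stays-private : ∀ {a u w} → u ∈ I → w ∈ comp u → Priv G A a w → ¬ InCN G (chosen u) w →
                    Priv G D₀ a w
    stays-private {a} {u} {w} u∈I w∈ (wa , only-a) undominated = wa , only-a′
      where
      only-a′ : ∀ y → y ∈ D₀ → CN G w y → y ≡ a
      only-a′ y y∈D₀ wy with ∈⟦⟧⁻ member? y∈D₀
      ... | inj₁ y∈A = only-a y y∈A wy
      ... | inj₂ (y∈I , y∈chosen) =
        ⊥-elim (undominated (y , subst (y ∈_) (chosen-coherent u∈I y∈C) y∈chosen , CN-sym wy))
        where y∈C = component-closed (proj₁ (comp-spec u∈I)) w∈ wy y∈I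

    partly-sees : ∀ {a u} → a ∈ A → PrivIR G I A a u → ¬ Saturated (comp u) →
                  PartlySees a (comp u)
    partly-sees {a} {u} a∈A ((ua , _) , u∈I) unsaturated =
      (u , proj₂ (comp-spec u∈I) , CN⇒E (CN-sym ua) a≢u) , non-neighbour
      where
      a≢u : a ≢ u
      a≢u a≡u = A⊆RN a a∈A (subst (_∈ I) (sym a≡u) u∈I)
      non-neighbour : Σ (Fin n) λ y → y ∈ comp u × ¬ CN G a y
      non-neighbour with find-counterexample (_∈? comp u) (InON? A) unsaturated
      ... | y , y∈ , y∉NA = y , y∈ , λ ay → y∉NA ((a , a∈A , ay) , λ y∈A →
              A⊆RN y y∈A (IsComponentOf.inside (proj₁ (comp-spec u∈I)) y y∈))

    -- All irredundant private neighbours of a ∈ A lying in unsaturated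
    -- components lie in one component, as a cannot partly see two.
    same-component : ∀ {a u w} → a ∈ A → PrivIR G I A a u → PrivIR G I A a w →
                     ¬ Saturated (comp u) → ¬ Saturated (comp w) → w ∈ comp u
    same-component {u = u} {w = w} a∈A priv-u@(_ , u∈I) priv-w@(_ , w∈I) unsat-u unsat-w with w ∈? comp u
    ... | yes w∈ = w∈
    ... | no w∉  = ⊥-elim (no-two-partial-components ch p9 (A⊆RN _ a∈A)
                            (proj₁ (comp-spec u∈I)) (proj₁ (comp-spec w∈I)) distinct
                            (partly-sees a∈A priv-u unsat-u) (partly-sees a∈A priv-w unsat-w))
      where
      distinct : comp u ≢ comp w
      distinct eq = w∉ (subst (w ∈_) (sym eq) (proj₂ (comp-spec w∈I)))

    not-in-B : ∀ {a} → (∀ {u} → PrivIR G I A a u → ¬ Saturated (comp u)) → ¬ InB G I A a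
    not-in-B unsaturated (_ , u , priv@(_ , u∈I) , C , comp-C , u∈C , sat) =
      unsaturated priv (subst Saturated (component-unique comp-C (proj₁ (comp-spec u∈I)) u∈C
                                                            (proj₂ (comp-spec u∈I))) sat)

    PrivIR? : ∀ a u → Dec (PrivIR G I A a u)
    PrivIR? a u = Priv? A a u ×-dec (u ∈? I)

    -- If an irredundant
    -- private neighbour lies in a saturated component, nothing was added
    -- there.  Otherwise a ∈ R_C(A) for the component C of any such
    -- neighbour u, so the set chosen for C misses some w ∈ Priv_IR(A, a),
    -- and w lies in C as well.
    private-in-D₀ : ∀ a → a ∈ A → Σ (Fin n) λ w → Priv G D₀ a w
    private-in-D₀ a a∈A with any? (λ u → PrivIR? a u ×-dec saturated? (comp u))
    ... | yes (u , (priv , u∈I) , sat) =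
      u , stays-private u∈I (proj₂ (comp-spec u∈I)) priv
            (λ (d , d∈ , _) → Fits.when-saturated (chosen-fits u∈I) sat d d∈)
    ... | no none-saturated =
      let (u , priv-u , u∈I) = has-private a a∈A
          a∈R : InRi G I A (comp u) a
          a∈R = (a∈A , not-in-B unsaturated) , u , proj₂ (comp-spec u∈I) , priv-u
          (_ , _ , misses-private) = Fits.when-open (chosen-fits u∈I) (unsaturated (priv-u , u∈I))
          (w , (priv-w , w∈I) , undominated) =
            find-counterexample (PrivIR? a) (InCN? (chosen u)) (misses-private a a∈R)
          w∈ = same-component a∈A (priv-u , u∈I) (priv-w , w∈I)
                 (unsaturated (priv-u , u∈I)) (unsaturated (priv-w , w∈I))
      in w , stays-private u∈I w∈ priv-w undominated
      where
      unsaturated : ∀ {u} → PrivIR G I A a u → ¬ Saturated (comp u)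
      unsaturated priv sat = none-saturated (_ , priv , sat)

    -- A minimal dominating D ⊆ D₀ contains A (each a ∈ A has a private
    -- neighbour w.r.t. D₀) and meets RN(G) only in A (as D₀ does).
    minimal-dominating : InDRN G I A
    minimal-dominating with minimal-dominating-subset D₀ (dominates-IR⇒dominates D₀-covers-IR)
    ... | D , D⊆D₀ , md = D , md , λ x → (λ x∈A → A⊆D x x∈A , A⊆RN x x∈A) , D∩RN⊆A x
      where
      A⊆D : SubsetOf G A D
      A⊆D a a∈A = private-survives D⊆D₀ (proj₁ md) (proj₂ (private-in-D₀ a a∈A))
      D∩RN⊆A : ∀ x → x ∈ D × x ∉ I → x ∈ A
      D∩RN⊆A x (x∈D , x∉I) with ∈⟦⟧⁻ member? (D⊆D₀ x x∈D)
      ... | inj₁ x∈A       = x∈A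
      ... | inj₂ (x∈I , _) = ⊥-elim (x∉I x∈I)

  necessity : InDRN G I A → Conditions
  necessity (D , md , D∩RN≡A) = private-in-A , λ C comp → D ∩ C , admissible C comp
    where open Necessity D md D∩RN≡A

  sufficiency : Chordal G → P9Free G → Conditions → InDRN G I A
  sufficiency ch p9 (has-private , admissible) = Sufficiency.minimal-dominating ch p9 has-private admissible

corollary10 : ∀ {n : ℕ} (G : Graph n) (I : Subset n) → IsIRChoice G I →
    P9Free G → Chordal G →
    (A : Subset n) → (∀ x → x ∈ A → x ∉ I) →
    (InDRN G I A ⇔
      ((∀ a → a ∈ A → Σ (Fin n) λ u → PrivIR G I A a u) ×
       (∀ C → IsComponentOf G I C →
          Σ (Subset n) λ D → SubsetOf G D C ×
            Dominates G D (λ y → y ∈ C × ¬ InON G A y) ×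
            (∀ x → InRi G I A C x → ¬ Dominates G D (PrivIR G I A x)))))
corollary10 G I isIR p9 ch A A⊆RN = mk⇔ necessity (sufficiency ch p9)
  where open Characterisation G I isIR A A⊆RN
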